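{- Let $G$ be an abelian group, let $g \in G \setminus \{0\}$ and let $H = \mathcal{B}_{\pm}(\{g\})$. (1) If the order of $g$ is even or infinite, then $H$ is isomorphic to $(\mathbb{N}_0, +)$; in particular $\Delta(H) = \emptyset$. (2) If the order of $g$ is odd, then $H$ is isomorphic to the numerical monoid $\langle 2, \operatorname{ord}(g)\rangle \subseteq (\mathbb{N}_0,+)$ generated by $2$ and $\operatorname{ord}(g)$; in particular $\Delta(H) = \{\operatorname{ord}(g) - 2\}$.
   Context: For a subset $G_0$ of an abelian group $G$, a sequence over $G_0$ is a finite unordered list $S = g_1\cdots g_\ell$ of elements of $G_0$ (repetitions allowed), forming the free commutative monoid over $G_0$ under concatenation. $S$ is a plus-minus weighted zero-sum sequence if $\sum_i \epsilon_i g_i = 0$ for some $\epsilon_i\in\{+1,-1\}$; $\mathcal{B}_{\pm}(G_0)$ is the monoid of these. For a monoid $H$ with trivial unit group: an atom is a non-identity element not a product of two non-identity elements; $\mathsf{L}_H(a)$ is the set of $k$ such that $a$ is a product of $k$ atoms; for finite $L=\{a_0<\dots<a_k\}$, $\Delta(L)=\{a_i-a_{i-1}\}$; $\Delta(H)=\bigcup_{a\in H}\Delta(\mathsf{L}_H(a))$. -}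

module Defs where

open import Level using (Level; _⊔_)
open import Algebra.Bundles using (AbelianGroup)
open import Algebra.Bundles.Raw using (RawMonoid)
open import Data.Nat using (ℕ; zero; suc; _+_; _*_; _<_)
open import Data.Nat.Properties using (+-assoc; +-comm; *-distribˡ-+)
open import Data.Product using (Σ; ∃; _×_; _,_; proj₁; proj₂)
open import Data.Sum using (_⊎_)
open import Data.Bool using (Bool; true; false)
open import Data.Unit using (⊤; tt)
open import Data.List using (List; []; _∷_; _++_; map; length; foldr)
open import Data.List.Properties using (map-++)
open import Data.List.Relation.Unary.All using (All)
open import Data.List.Relation.Binary.Permutation.Propositional using (_↭_)
open import Relation.Nullary using (¬_)
open import Relation.Binary.PropositionalEquality
  using (_≡_)
import Relation.Binary.PropositionalEquality as P
import Data.Nat.Properties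

module Factorization {c ℓ : Level} (M : RawMonoid c ℓ) where
  open RawMonoid M

  IsAtom : Carrier → Set (c ⊔ ℓ)
  IsAtom a = ¬ (a ≈ ε) × (∀ b d → a ≈ b ∙ d → (b ≈ ε) ⊎ (d ≈ ε))

  prod : List Carrier → Carrier
  prod = foldr _∙_ ε

  _∈L_ : ℕ → Carrier → Set (c ⊔ ℓ)
  k ∈L a = Σ (List Carrier) λ as → All IsAtom as × length as ≡ k × a ≈ prod as

  _∈Δset_ : ℕ → (ℕ → Set (c ⊔ ℓ)) → Set (c ⊔ ℓ)
  d ∈Δset L = Σ ℕ λ l → L l × L (l + d) × 0 < d
                × (∀ j → l < j → j < l + d → ¬ L j)

  _∈Δ : ℕ → Set (c ⊔ ℓ)
  d ∈Δ = Σ Carrier λ a → d ∈Δset (λ k → k ∈L a)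

module GroupNotions {c ℓ : Level} (G : AbelianGroup c ℓ) where
  open AbelianGroup G

  _·_ : ℕ → Carrier → Carrier
  zero  · g = ε
  suc n · g = g ∙ (n · g)

  HasOrder : Carrier → ℕ → Set ℓ
  HasOrder g n = 0 < n × (n · g) ≈ ε × (∀ k → 0 < k → k < n → ¬ ((k · g) ≈ ε))

  InfiniteOrder : Carrier → Set ℓ
  InfiniteOrder g = ∀ k → 0 < k → ¬ ((k · g) ≈ ε)

  -- Sequences over G₀ = image of an enumeration ι : X → G are elements of
  -- the free commutative monoid over X, i.e. lists over X up to
  -- permutation (_↭_), with concatenation.

  signed : {X : Set} → (X → Carrier) → Bool × X → Carrier
  signed ι (true  , x) = ι x
  signed ι (false , x) = (ι x) ⁻¹

  signedSum : {X : Set} → (X → Carrier) → List (Bool × X) → Carrier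
  signedSum ι = foldr (λ p s → signed ι p ∙ s) ε

  IsPMZeroSum : {X : Set} → (X → Carrier) → List X → Set ℓ
  IsPMZeroSum {X} ι S = Σ (List (Bool × X)) λ es → map proj₂ es ≡ S × signedSum ι es ≈ ε

  private
    signedSum-++ : {X : Set} (ι : X → Carrier) (xs ys : List (Bool × X)) →
                   signedSum ι (xs ++ ys) ≈ signedSum ι xs ∙ signedSum ι ys
    signedSum-++ ι [] ys = sym (identityˡ _)
    signedSum-++ ι (p ∷ xs) ys =
      trans (∙-cong refl (signedSum-++ ι xs ys)) (sym (assoc _ _ _))

  pm-++ : {X : Set} (ι : X → Carrier) {S T : List X} →
          IsPMZeroSum ι S → IsPMZeroSum ι T → IsPMZeroSum ι (S ++ T)
  pm-++ ι (es , p , z) (fs , q , w) =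
    es ++ fs , P.trans (map-++ proj₂ es fs) (P.cong₂ _++_ p q) ,
    trans (signedSum-++ ι es fs) (trans (∙-cong z w) (identityˡ ε))

  pm-[] : {X : Set} (ι : X → Carrier) → IsPMZeroSum ι []
  pm-[] ι = [] , P.refl , refl

  B± : {X : Set} → (X → Carrier) → RawMonoid ℓ Level.zero
  B± {X} ι = record
    { Carrier = Σ (List X) (IsPMZeroSum ι)
    ; _≈_     = λ S T → proj₁ S ↭ proj₁ T
    ; _∙_     = λ S T → (proj₁ S ++ proj₁ T) , pm-++ ι (proj₂ S) (proj₂ T)
    ; ε       = [] , pm-[] ι
    }

  B±single : Carrier → RawMonoid ℓ Level.zero
  B±single g = B± {⊤} (λ _ → g)

ℕ+ : RawMonoid Level.zero Level.zero
ℕ+ = record { Carrier = ℕ ; _≈_ = _≡_ ; _∙_ = _+_ ; ε = 0 }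

In⟨2,_⟩ : ℕ → ℕ → Set
In⟨2, m ⟩ n = Σ ℕ λ a → Σ ℕ λ b → n ≡ 2 * a + m * b

private
  in-+ : ∀ m {x y} → In⟨2, m ⟩ x → In⟨2, m ⟩ y → In⟨2, m ⟩ (x + y)
  in-+ m (a , b , P.refl) (a' , b' , P.refl) =
    a + a' , b + b' ,
    P.trans (shuffle (2 * a) (m * b) (2 * a') (m * b'))
          (P.sym (P.cong₂ _+_ (*-distribˡ-+ 2 a a') (*-distribˡ-+ m b b')))
    where
      shuffle : ∀ p q r s → (p + q) + (r + s) ≡ (p + r) + (q + s)
      shuffle p q r s =
        P.trans (+-assoc p q (r + s))
       (P.trans (P.cong (p +_) (P.trans (P.sym (+-assoc q r s))
                             (P.trans (P.cong (_+ s) (+-comm q r)) (+-assoc r q s))))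
              (P.sym (+-assoc p r (q + s))))

⟨2,_⟩ : ℕ → RawMonoid Level.zero Level.zero
⟨2, m ⟩ = record
  { Carrier = Σ ℕ In⟨2, m ⟩
  ; _≈_     = λ x y → proj₁ x ≡ proj₁ y
  ; _∙_     = λ x y → (proj₁ x + proj₁ y) , in-+ m (proj₂ x) (proj₂ y)
  ; ε       = 0 , 0 , 0 , P.sym lem
  }
  where
    lem : 2 * 0 + m * 0 ≡ 0
    lem rewrite Data.Nat.Properties.*-zeroʳ m = P.refl

Even Odd : ℕ → Set
Even n = Σ ℕ λ k → n ≡ 2 * k
Odd  n = Σ ℕ λ k → n ≡ suc (2 * k)

-- A sequence over {g} is determined by its length, and a length occurs exactly when it has the
-- form 2u + e with e·g = 0 (u cancelling pairs g, −g followed by e copies of g). Writing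
-- m = ord g (m = 0 for infinite order), the length map therefore identifies B±({g}) with the
-- numerical monoid ⟨2, m⟩, and factorisations are computed there. For even m this is 2ℕ ≅ ℕ,
-- where every element has a single factorisation length. For odd m ≥ 3 the atoms are 2 and m;
-- a factorisation of n of length k with b atoms equal to m satisfies n = 2k + (m − 2)b, and as
-- m − 2 is odd the parity of b is determined by n, so the lengths of n form an arithmetic
-- progression of difference m − 2. The element 2m = m + m = 2 + ⋯ + 2 shows that this difference
-- occurs.

module Submission where

open import Defs
open import Level using (Level)
open import Algebra.Bundles using (AbelianGroup)
open import Algebra.Bundles.Raw using (RawMonoid)
open import Algebra.Morphism.Structures using (module MonoidMorphisms)
open import Data.Bool using (Bool; true; false)
open import Data.Empty using (⊥; ⊥-elim)
open import Data.List using (List; []; _∷_; _++_; map; length; replicate)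
open import Data.List.Properties using (length-map; length-++; length-replicate)
open import Data.List.Relation.Unary.All as All using (All; []; _∷_)
open import Data.List.Relation.Unary.All.Properties using (map⁺; ++⁺; replicate⁺)
open import Data.List.Relation.Binary.Permutation.Propositional using (_↭_; ↭-refl)
open import Data.List.Relation.Binary.Permutation.Propositional.Properties using (↭-length)
open import Data.Nat using (ℕ; zero; suc; _+_; _*_; _∸_; _≤_; _<_; z≤n; s≤s; z<s; NonZero; >-nonZero)
open import Data.Unit using (⊤; tt)
open import Data.Nat.DivMod using (_%_; _/_; m≡m%n+[m/n]*n; m%n<n; m*n/n≡m)
open import Data.Nat.Divisibility using (_∣_; divides; m%n≡0⇒n∣m; _∣0; 0∣⇒≡0)
open import Data.Nat.ListAction using (sum)
open import Data.Nat.ListAction.Properties using (sum-++)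
open import Data.Nat.Properties
  using (suc-injective; +-suc; +-comm; +-identityʳ; *-suc; *-zeroʳ; *-identityʳ; *-comm;
         *-distribˡ-+; +-cancelˡ-≡; *-cancelˡ-≡; +-cancelˡ-≤; n≤0⇒n≡0; m≤m+n; m≤n+m;
         m<m+n; m<n+m; +-monoʳ-<; *-monoʳ-≤; ≤-trans; ≤-reflexive; ≤-total; <-≤-trans;
         <⇒≱; >⇒≢; module ≤-Reasoning; m<m*n; m≤m*n; +-monoʳ-≤; m≤n⇒m≤1+n; m≤n⇒∃[o]m+o≡n; m*n≡1⇒m≡1; even≢odd)
open import Data.Nat.Tactic.RingSolver using (solve-∀)
open import Data.Product using (Σ; ∃; _×_; _,_; proj₁; proj₂)
open import Data.Sum as Sum using (_⊎_; inj₁; inj₂)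
open import Function.Bundles using (_⇔_; mk⇔; Equivalence)
open import Function.Construct.Composition using (_⇔-∘_)
open import Relation.Nullary using (¬_; contradiction)
open import Relation.Binary.PropositionalEquality as ≡
  using (_≡_; _≢_; refl; cong; cong₂; subst)

even⊎odd : ∀ n → Even n ⊎ Odd n
even⊎odd zero = inj₁ (0 , refl)
even⊎odd (suc n) with even⊎odd n
... | inj₁ (k , n≡2k)   = inj₂ (k , cong suc n≡2k)
... | inj₂ (k , n≡1+2k) = inj₁ (suc k , ≡.trans (cong suc n≡1+2k) (≡.sym (*-suc 2 k)))

even∧odd⇒⊥ : ∀ {n} → Even n → Odd n → ⊥
even∧odd⇒⊥ (a , n≡2a) (b , n≡1+2b) = even≢odd a b (≡.trans (≡.sym n≡2a) n≡1+2b)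

even-+ : ∀ {i j} → Even i → Even j → Even (i + j)
even-+ (a , refl) (b , refl) = a + b , ≡.sym (*-distribˡ-+ 2 a b)

odd-* : ∀ {i j} → Odd i → Odd j → Odd (i * j)
odd-* (a , refl) (b , refl) = a + b + 2 * a * b , lemma a b
  where
  lemma : ∀ a b → suc (2 * a) * suc (2 * b) ≡ suc (2 * (a + b + 2 * a * b))
  lemma = solve-∀

odd⇒>0 : ∀ {n} → Odd n → 0 < n
odd⇒>0 (_ , refl) = z<s

sum-replicate : ∀ n x → sum (replicate n x) ≡ n * x
sum-replicate zero    x = refl
sum-replicate (suc n) x = cong (x +_) (sum-replicate n x)

in⟨2,⟩-2* : ∀ m a → In⟨2, m ⟩ (2 * a)
in⟨2,⟩-2* m a = a , 0 , lemma a m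
  where
  lemma : ∀ a m → 2 * a ≡ 2 * a + m * 0
  lemma = solve-∀

in⟨2,⟩-m : ∀ m → In⟨2, m ⟩ m
in⟨2,⟩-m m = 0 , 1 , ≡.sym (*-identityʳ m)

in⟨2,⟩-even : ∀ {m k} → Even m → In⟨2, m ⟩ k → Even k
in⟨2,⟩-even (h , refl) (a , b , refl) = a + h * b , lemma a b h
  where
  lemma : ∀ a b h → 2 * a + 2 * h * b ≡ 2 * (a + h * b)
  lemma = solve-∀

in⟨2,⟩⇒≥m⊎even : ∀ {m i} → In⟨2, m ⟩ i → m ≤ i ⊎ Even i
in⟨2,⟩⇒≥m⊎even {m} (a , zero , refl) = inj₂ (a , ≡.trans (cong (2 * a +_) (*-zeroʳ m)) (+-identityʳ _))
in⟨2,⟩⇒≥m⊎even {m} (a , suc b , refl) =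
  inj₁ (≤-trans (m≤m+n m (m * b)) (≤-trans (≤-reflexive (≡.sym (*-suc m b))) (m≤n+m _ (2 * a))))

1∉⟨2,⟩ : ∀ {m} → m ≢ 1 → ¬ In⟨2, m ⟩ 1
1∉⟨2,⟩ {m} m≢1 (zero  , b , 1≡mb) = m≢1 (m*n≡1⇒m≡1 m b (≡.sym 1≡mb))
1∉⟨2,⟩ {m} m≢1 (suc a , b , 1≡)   = 1≢2+ (≡.trans 1≡ (lemma a b m))
  where
  lemma : ∀ a b m → 2 * suc a + m * b ≡ 2 + (2 * a + m * b)
  lemma = solve-∀
  1≢2+ : ∀ {n} → 1 ≢ 2 + n
  1≢2+ ()

Atom⟨2,_⟩ : ℕ → ℕ → Set
Atom⟨2, m ⟩ k = In⟨2, m ⟩ k × k ≢ 0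
  × (∀ i j → In⟨2, m ⟩ i → In⟨2, m ⟩ j → k ≡ i + j → i ≡ 0 ⊎ j ≡ 0)

atom-summand : ∀ {m k i j} → Atom⟨2, m ⟩ k → In⟨2, m ⟩ i → In⟨2, m ⟩ j →
               k ≡ i + j → i ≢ 0 → k ≡ i
atom-summand {i = i} (_ , _ , split) i∈ j∈ k≡i+j i≢0 with split _ _ i∈ j∈ k≡i+j
... | inj₁ i≡0 = contradiction i≡0 i≢0
... | inj₂ j≡0 = ≡.trans k≡i+j (≡.trans (cong (i +_) j≡0) (+-identityʳ i))

atom⇒≡2⊎≡m : ∀ {m k} → Atom⟨2, m ⟩ k → k ≡ 2 ⊎ k ≡ m
atom⇒≡2⊎≡m {m} k-atom@((suc a , b , k≡) , _) =
  inj₁ (atom-summand {m} k-atom (in⟨2,⟩-2* m 1) (a , b , refl) (≡.trans k≡ (lemma a b m)) (λ ()))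
  where
  lemma : ∀ a b m → 2 * suc a + m * b ≡ 2 + (2 * a + m * b)
  lemma = solve-∀
atom⇒≡2⊎≡m {m} ((zero , zero , k≡) , k≢0 , _) = contradiction (≡.trans k≡ (*-zeroʳ m)) k≢0
atom⇒≡2⊎≡m {m} k-atom@((zero , suc b , k≡) , k≢0 , _) =
  inj₂ (atom-summand {m} k-atom (in⟨2,⟩-m m) (0 , b , refl) (≡.trans k≡ (*-suc m b)) m≢0)
  where
  m≢0 : m ≢ 0
  m≢0 m≡0 = k≢0 (≡.trans k≡ (cong (_* suc b) m≡0))

atom-even⇒≡2 : ∀ {m k} → Atom⟨2, m ⟩ k → Even k → k ≡ 2
atom-even⇒≡2 (_ , k≢0 , _) (zero , k≡0) = contradiction k≡0 k≢0
atom-even⇒≡2 _ (suc zero , k≡2) = k≡2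
atom-even⇒≡2 {m} {k} k-atom (suc (suc j) , k≡)
  with ≡.trans (≡.sym k≡2+2j) (atom-summand {m} k-atom (in⟨2,⟩-2* m 1) (in⟨2,⟩-2* m (suc j)) k≡2+2j (λ ()))
  where
  k≡2+2j : k ≡ 2 + 2 * suc j
  k≡2+2j = ≡.trans k≡ (*-suc 2 (suc j))
... | ()

atom-2 : ∀ {m} → m ≢ 1 → Atom⟨2, m ⟩ 2
atom-2 {m} m≢1 = in⟨2,⟩-2* m 1 , (λ ()) , split
  where
  split : ∀ i j → In⟨2, m ⟩ i → In⟨2, m ⟩ j → 2 ≡ i + j → i ≡ 0 ⊎ j ≡ 0
  split zero                _ _  _ _  = inj₁ refl
  split (suc zero)          _ 1∈ _ _  = contradiction 1∈ (1∉⟨2,⟩ m≢1)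
  split (suc (suc zero))    _ _  _ 2≡ = inj₂ (≡.sym (suc-injective (suc-injective 2≡)))
  split (suc (suc (suc _))) _ _  _ ()

m≡i+j⇒m≤i⇒j≡0 : ∀ {m i j} → m ≡ i + j → m ≤ i → j ≡ 0
m≡i+j⇒m≤i⇒j≡0 {m} {i} {j} m≡i+j m≤i = n≤0⇒n≡0 (+-cancelˡ-≤ i j 0 (begin
  i + j  ≡⟨ m≡i+j ⟨
  m      ≤⟨ m≤i ⟩
  i      ≡⟨ +-identityʳ i ⟨
  i + 0  ∎))
  where open ≤-Reasoning

atom-odd : ∀ {m} → Odd m → Atom⟨2, m ⟩ m
atom-odd {m} m-odd = in⟨2,⟩-m m , >⇒≢ (odd⇒>0 m-odd) , split
  where
  split : ∀ i j → In⟨2, m ⟩ i → In⟨2, m ⟩ j → m ≡ i + j → i ≡ 0 ⊎ j ≡ 0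
  split i j i∈ j∈ m≡i+j with in⟨2,⟩⇒≥m⊎even i∈ | in⟨2,⟩⇒≥m⊎even j∈
  ... | inj₁ m≤i | _        = inj₂ (m≡i+j⇒m≤i⇒j≡0 m≡i+j m≤i)
  ... | inj₂ _   | inj₁ m≤j = inj₁ (m≡i+j⇒m≤i⇒j≡0 (≡.trans m≡i+j (+-comm i j)) m≤j)
  ... | inj₂ i-even | inj₂ j-even =
    ⊥-elim (even∧odd⇒⊥ (subst Even (≡.sym m≡i+j) (even-+ i-even j-even)) m-odd)

_∈L⟨2,_⟩_ : ℕ → ℕ → ℕ → Set
k ∈L⟨2, m ⟩ n = Σ (List ℕ) λ vs → All Atom⟨2, m ⟩ vs × length vs ≡ k × n ≡ sum vs

sum-atoms-even : ∀ {m vs} → Even m → All Atom⟨2, m ⟩ vs → sum vs ≡ 2 * length vs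
sum-atoms-even m-even [] = refl
sum-atoms-even {m} {_ ∷ vs} m-even (v-atom ∷ vs-atoms) =
  ≡.trans (cong₂ _+_ (atom-even⇒≡2 {m} v-atom (in⟨2,⟩-even m-even (proj₁ v-atom)))
                     (sum-atoms-even m-even vs-atoms))
          (≡.sym (*-suc 2 (length vs)))

∈L⟨2,⟩-even : ∀ {m k n} → Even m → k ∈L⟨2, m ⟩ n → n ≡ 2 * k
∈L⟨2,⟩-even m-even (_ , vs-atoms , refl , n≡) = ≡.trans n≡ (sum-atoms-even m-even vs-atoms)

-- n = 2 k + m' b says that n is a sum of k atoms of ⟨2, 2 + m'⟩, b of which equal 2 + m'.
Len⟨2,2+_⟩ : ℕ → ℕ → ℕ → Set
Len⟨2,2+ m' ⟩ n k = Σ ℕ λ b → b ≤ k × n ≡ 2 * k + m' * b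

sum-atoms-Len : ∀ {m m' vs} → m ≡ 2 + m' → All Atom⟨2, m ⟩ vs → Len⟨2,2+ m' ⟩ (sum vs) (length vs)
sum-atoms-Len {m' = m'} _ [] = 0 , z≤n , ≡.sym (*-zeroʳ m')
sum-atoms-Len {m' = m'} {vs = v ∷ vs} m≡2+m' (v-atom ∷ vs-atoms)
  with sum-atoms-Len m≡2+m' vs-atoms | atom⇒≡2⊎≡m v-atom
... | b , b≤ , s≡ | inj₁ v≡2 =
  b , m≤n⇒m≤1+n b≤ , ≡.trans (cong₂ _+_ v≡2 s≡) (lemma (length vs) b m')
  where
  lemma : ∀ k b m' → 2 + (2 * k + m' * b) ≡ 2 * suc k + m' * b
  lemma = solve-∀
... | b , b≤ , s≡ | inj₂ v≡m =
  suc b , s≤s b≤ , ≡.trans (cong₂ _+_ (≡.trans v≡m m≡2+m') s≡) (lemma (length vs) b m')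
  where
  lemma : ∀ k b m' → (2 + m') + (2 * k + m' * b) ≡ 2 * suc k + m' * suc b
  lemma = solve-∀

odd-2+ : ∀ {m'} → Odd m' → Odd (2 + m')
odd-2+ (r , refl) = suc r , lemma r
  where
  lemma : ∀ r → 2 + suc (2 * r) ≡ suc (2 * suc r)
  lemma = solve-∀

Len⇒∈L⟨2,⟩ : ∀ {m' n k} → Odd m' → Len⟨2,2+ m' ⟩ n k → k ∈L⟨2, 2 + m' ⟩ n
Len⇒∈L⟨2,⟩ {m'} m'-odd (b , b≤k , refl) with m≤n⇒∃[o]m+o≡n b≤k
... | e , refl =
  replicate e 2 ++ replicate b (2 + m') ,
  ++⁺ (replicate⁺ e (atom-2 {2 + m'} (λ ()))) (replicate⁺ b (atom-odd (odd-2+ m'-odd))) ,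
  ≡.trans (length-++ (replicate e 2)) (≡.trans (cong₂ _+_ (length-replicate e) (length-replicate b)) (+-comm e b)) ,
  ≡.trans (lemma b e m')
    (≡.sym (≡.trans (sum-++ (replicate e 2) _) (cong₂ _+_ (sum-replicate e 2) (sum-replicate b (2 + m')))))
  where
  lemma : ∀ b e m' → 2 * (b + e) + m' * b ≡ e * 2 + b * (2 + m')
  lemma = solve-∀

∈L⟨2,⟩⇔Len : ∀ {m m' k n} → m ≡ 2 + m' → Odd m' → k ∈L⟨2, m ⟩ n ⇔ Len⟨2,2+ m' ⟩ n k
∈L⟨2,⟩⇔Len {m' = m'} refl m'-odd = mk⇔ to (Len⇒∈L⟨2,⟩ m'-odd)
  where
  to : ∀ {k n} → k ∈L⟨2, 2 + m' ⟩ n → Len⟨2,2+ m' ⟩ n k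
  to (_ , vs-atoms , refl , refl) = sum-atoms-Len {m' = m'} refl vs-atoms

*-cancel-difference : ∀ {m' d b₁ b₂} → 0 < d → m' * b₁ ≡ 2 * d + m' * b₂ →
                      ∃ λ e → b₁ ≡ b₂ + e × m' * e ≡ 2 * d
*-cancel-difference {m'} {d} {b₁} {b₂} 0<d eq with ≤-total b₁ b₂
... | inj₁ b₁≤b₂ = contradiction (*-monoʳ-≤ m' b₁≤b₂) (<⇒≱ m'b₂<m'b₁)
  where
  m'b₂<m'b₁ : m' * b₂ < m' * b₁
  m'b₂<m'b₁ = subst (m' * b₂ <_) (≡.sym eq) (m<n+m (m' * b₂) (<-≤-trans 0<d (m≤m+n d (d + 0))))
... | inj₂ b₂≤b₁ with m≤n⇒∃[o]m+o≡n b₂≤b₁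
...   | e , refl =
  e , refl , +-cancelˡ-≡ (m' * b₂) _ _ (≡.trans (≡.sym (*-distribˡ-+ m' b₂ e)) (≡.trans eq (+-comm (2 * d) _)))

odd*e≡2*d⇒multiple : ∀ {m' e d} → Odd m' → 0 < d → m' * e ≡ 2 * d → ∃ λ t → d ≡ m' * suc t
odd*e≡2*d⇒multiple {m'} {e} {d} m'-odd 0<d m'e≡2d with even⊎odd e
... | inj₂ e-odd = ⊥-elim (even∧odd⇒⊥ (d , m'e≡2d) (odd-* m'-odd e-odd))
... | inj₁ (t , refl) with *-cancelˡ-≡ d (m' * t) 2 (≡.trans (≡.sym m'e≡2d) (lemma m' t))
  where
  lemma : ∀ m' t → m' * (2 * t) ≡ 2 * (m' * t)
  lemma = solve-∀
...   | d≡m't with t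
...     | zero  = contradiction (≡.trans d≡m't (*-zeroʳ m')) (>⇒≢ 0<d)
...     | suc t = t , d≡m't

Len-gap : ∀ {m' n k d} → Odd m' → Len⟨2,2+ m' ⟩ n k → Len⟨2,2+ m' ⟩ n (k + d) → 0 < d →
          ∃ λ t → d ≡ m' * suc t
Len-gap {m'} {n} {k} {d} m'-odd (b₁ , _ , n≡₁) (b₂ , _ , n≡₂) 0<d
  with *-cancel-difference {m'} 0<d (+-cancelˡ-≡ (2 * k) _ _ (≡.trans (≡.sym n≡₁) (≡.trans n≡₂ (lemma k d m' b₂))))
  where
  lemma : ∀ k d m' b → 2 * (k + d) + m' * b ≡ 2 * k + (2 * d + m' * b)
  lemma = solve-∀
... | _ , _ , m'e≡2d = odd*e≡2*d⇒multiple m'-odd 0<d m'e≡2d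

Len-step : ∀ {m' n k t} → Odd m' → Len⟨2,2+ m' ⟩ n k → Len⟨2,2+ m' ⟩ n (k + m' * suc t) →
           Len⟨2,2+ m' ⟩ n (k + m')
Len-step {m'} {n} {k} {t} (r , refl) (b₁ , b₁≤k , n≡₁) (b₂ , _ , n≡₂) =
  2 * t + b₂ , b≤k+m' , ≡.trans n≡₁ (≡.trans (cong (λ b → 2 * k + m' * b) b₁≡) (lemma₂ k t b₂ m'))
  where
  lemma₁ : ∀ k t b m' → 2 * (k + m' * suc t) + m' * b ≡ 2 * k + m' * (2 + (2 * t + b))
  lemma₁ = solve-∀
  lemma₂ : ∀ k t b m' → 2 * k + m' * (2 + (2 * t + b)) ≡ 2 * (k + m') + m' * (2 * t + b)
  lemma₂ = solve-∀
  b₁≡ : b₁ ≡ 2 + (2 * t + b₂)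
  b₁≡ = *-cancelˡ-≡ b₁ _ m' (+-cancelˡ-≡ (2 * k) _ _ (≡.trans (≡.sym n≡₁) (≡.trans n≡₂ (lemma₁ k t b₂ m'))))
  b≤k+m' : 2 * t + b₂ ≤ k + m'
  b≤k+m' = ≤-trans (m≤n+m _ 2) (≤-trans (≤-reflexive (≡.sym b₁≡)) (≤-trans b₁≤k (m≤m+n k m')))

Len-consecutive : ∀ {m' n l d} → Odd m' → Len⟨2,2+ m' ⟩ n l → Len⟨2,2+ m' ⟩ n (l + d) → 0 < d →
                  (∀ j → l < j → j < l + d → ¬ Len⟨2,2+ m' ⟩ n j) → d ≡ m'
Len-consecutive {m'} {l = l} m'-odd@(_ , refl) l∈ l+d∈ 0<d gap with Len-gap m'-odd l∈ l+d∈ 0<d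
... | zero  , d≡m' = ≡.trans d≡m' (*-identityʳ m')
... | suc t , refl =
  contradiction (Len-step m'-odd l∈ l+d∈)
    (gap (l + m') (m<m+n l z<s) (+-monoʳ-< l (m<m*n m' (suc (suc t)) (s≤s (s≤s z≤n)))))

Len-spacing : ∀ {m' n k j} → Odd m' → Len⟨2,2+ m' ⟩ n k → Len⟨2,2+ m' ⟩ n j → k < j → k + m' ≤ j
Len-spacing {m'} {n} {k} m'-odd k∈ j∈ k<j with m≤n⇒∃[o]m+o≡n k<j
... | o , refl with Len-gap m'-odd k∈ (subst (Len⟨2,2+ m' ⟩ n) (≡.sym (+-suc k o)) j∈) z<s
... | t , 1+o≡m'*[1+t] =
  ≤-trans (+-monoʳ-≤ k (≤-trans (m≤m*n m' (suc t)) (≤-reflexive (≡.sym 1+o≡m'*[1+t]))))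
          (≤-reflexive (+-suc k o))

module LengthEmbedding
  {c ℓ} (M : RawMonoid c ℓ) (μ : RawMonoid.Carrier M → ℕ)
  (μ-mono : MonoidMorphisms.IsMonoidMonomorphism M ℕ+ μ)
  (m : ℕ)
  (μ-image : ∀ x → In⟨2, m ⟩ (μ x))
  (μ-onto : ∀ {n} → In⟨2, m ⟩ n → Σ (RawMonoid.Carrier M) λ x → μ x ≡ n)
  where

  open RawMonoid M using (Carrier; _≈_; _∙_; ε)
  open MonoidMorphisms.IsMonoidMonomorphism μ-mono
    using () renaming (⟦⟧-cong to μ-cong; homo to μ-homo; ε-homo to μ-ε; injective to μ-injective)
  open Factorization M

  μ≡0⇒≈ε : ∀ {x} → μ x ≡ 0 → x ≈ ε
  μ≡0⇒≈ε μx≡0 = μ-injective (≡.trans μx≡0 (≡.sym μ-ε))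

  ≈ε⇒μ≡0 : ∀ {x} → x ≈ ε → μ x ≡ 0
  ≈ε⇒μ≡0 x≈ε = ≡.trans (μ-cong x≈ε) μ-ε

  μ-prod : ∀ xs → μ (prod xs) ≡ sum (map μ xs)
  μ-prod []       = μ-ε
  μ-prod (x ∷ xs) = ≡.trans (μ-homo x (prod xs)) (cong (μ x +_) (μ-prod xs))

  isAtom⇒atom : ∀ {x} → IsAtom x → Atom⟨2, m ⟩ (μ x)
  isAtom⇒atom {x} (x≉ε , split) = μ-image x , (λ μx≡0 → x≉ε (μ≡0⇒≈ε μx≡0)) , split′
    where
    split′ : ∀ i j → In⟨2, m ⟩ i → In⟨2, m ⟩ j → μ x ≡ i + j → i ≡ 0 ⊎ j ≡ 0
    split′ i j i∈ j∈ μx≡i+j with μ-onto i∈ | μ-onto j∈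
    ... | y , refl | z , refl =
      Sum.map ≈ε⇒μ≡0 ≈ε⇒μ≡0 (split y z (μ-injective (≡.trans μx≡i+j (≡.sym (μ-homo y z)))))

  atom⇒isAtom : ∀ {x} → Atom⟨2, m ⟩ (μ x) → IsAtom x
  atom⇒isAtom {x} (_ , μx≢0 , split) = (λ x≈ε → μx≢0 (≈ε⇒μ≡0 x≈ε)) , split′
    where
    split′ : ∀ y z → x ≈ y ∙ z → y ≈ ε ⊎ z ≈ ε
    split′ y z x≈yz =
      Sum.map μ≡0⇒≈ε μ≡0⇒≈ε
        (split (μ y) (μ z) (μ-image y) (μ-image z) (≡.trans (μ-cong x≈yz) (μ-homo y z)))

  lift-atoms : ∀ {vs} → All Atom⟨2, m ⟩ vs → Σ (List Carrier) λ xs → All IsAtom xs × map μ xs ≡ vs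
  lift-atoms [] = [] , [] , refl
  lift-atoms (v-atom ∷ vs-atoms) with μ-onto (proj₁ v-atom) | lift-atoms vs-atoms
  ... | x , refl | xs , xs-atoms , refl = x ∷ xs , atom⇒isAtom v-atom ∷ xs-atoms , refl

  ∈L⇔∈L⟨2,⟩ : ∀ {k x} → k ∈L x ⇔ k ∈L⟨2, m ⟩ μ x
  ∈L⇔∈L⟨2,⟩ {k} {x} = mk⇔ to from
    where
    to : k ∈L x → k ∈L⟨2, m ⟩ μ x
    to (xs , xs-atoms , refl , x≈) =
      map μ xs , map⁺ (All.map isAtom⇒atom xs-atoms) , length-map μ xs , ≡.trans (μ-cong x≈) (μ-prod xs)
    from : k ∈L⟨2, m ⟩ μ x → k ∈L x
    from (vs , vs-atoms , refl , μx≡) with lift-atoms vs-atoms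
    ... | xs , xs-atoms , refl =
      xs , xs-atoms , ≡.sym (length-map μ xs) , μ-injective (≡.trans μx≡ (≡.sym (μ-prod xs)))

  toNumerical : Carrier → RawMonoid.Carrier ⟨2, m ⟩
  toNumerical x = μ x , μ-image x

  toNumerical-isMonoidIsomorphism : MonoidMorphisms.IsMonoidIsomorphism M ⟨2, m ⟩ toNumerical
  toNumerical-isMonoidIsomorphism = record
    { isMonoidMonomorphism = record
      { isMonoidHomomorphism = record
        { isMagmaHomomorphism = record
          { isRelHomomorphism = record { cong = μ-cong }
          ; homo = μ-homo
          }
        ; ε-homo = μ-ε
        }
      ; injective = μ-injective
      }
    ; surjective = λ (n , n∈) → proj₁ (μ-onto n∈) , λ z≈ → ≡.trans (μ-cong z≈) (proj₂ (μ-onto n∈))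
    }

  module _ (m-even : Even m) where

    halve : Carrier → ℕ
    halve x = μ x / 2

    μ≡2*halve : ∀ x → μ x ≡ 2 * halve x
    μ≡2*halve x with in⟨2,⟩-even m-even (μ-image x)
    ... | h , μx≡2h = ≡.trans μx≡2h (cong (2 *_) (≡.sym (≡.trans (cong (_/ 2) μx≡2h) (2*h/2≡h h))))
      where
      2*h/2≡h : ∀ h → 2 * h / 2 ≡ h
      2*h/2≡h h = ≡.trans (cong (_/ 2) (*-comm 2 h)) (m*n/n≡m h 2)

    halve-cancel : ∀ {x k} → μ x ≡ 2 * k → halve x ≡ k
    halve-cancel {x} {k} μx≡2k = *-cancelˡ-≡ _ _ 2 (≡.trans (≡.sym (μ≡2*halve x)) μx≡2k)

    halve-isMonoidIsomorphism : MonoidMorphisms.IsMonoidIsomorphism M ℕ+ halve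
    halve-isMonoidIsomorphism = record
      { isMonoidMonomorphism = record
        { isMonoidHomomorphism = record
          { isMagmaHomomorphism = record
            { isRelHomomorphism = record { cong = λ x≈y → cong (_/ 2) (μ-cong x≈y) }
            ; homo = λ x y → halve-cancel (≡.trans (μ-homo x y)
                       (≡.trans (cong₂ _+_ (μ≡2*halve x) (μ≡2*halve y)) (≡.sym (*-distribˡ-+ 2 (halve x) (halve y)))))
            }
          ; ε-homo = cong (_/ 2) μ-ε
          }
        ; injective = λ {x} {y} hx≡hy →
            μ-injective (≡.trans (μ≡2*halve x) (≡.trans (cong (2 *_) hx≡hy) (≡.sym (μ≡2*halve y))))
        }
      ; surjective = λ k → proj₁ (μ-onto (in⟨2,⟩-2* m k)) ,
          λ z≈ → halve-cancel (≡.trans (μ-cong z≈) (proj₂ (μ-onto (in⟨2,⟩-2* m k))))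
      }

    ∈L⇒μ≡2* : ∀ {k x} → k ∈L x → μ x ≡ 2 * k
    ∈L⇒μ≡2* k∈ = ∈L⟨2,⟩-even m-even (Equivalence.to ∈L⇔∈L⟨2,⟩ k∈)

    Δ-empty : ∀ d → ¬ d ∈Δ
    Δ-empty d (x , l , l∈ , l+d∈ , 0<d , _) =
      >⇒≢ 0<d (+-cancelˡ-≡ l d 0 (≡.trans (≡.sym l≡l+d) (≡.sym (+-identityʳ l))))
      where
      l≡l+d : l ≡ l + d
      l≡l+d = *-cancelˡ-≡ _ _ 2 (≡.trans (≡.sym (∈L⇒μ≡2* l∈)) (∈L⇒μ≡2* l+d∈))

  module _ {m'} (m≡2+m' : m ≡ 2 + m') (m'-odd : Odd m') where

    ∈L⇔Len : ∀ {k x} → k ∈L x ⇔ Len⟨2,2+ m' ⟩ (μ x) k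
    ∈L⇔Len = ∈L⟨2,⟩⇔Len m≡2+m' m'-odd ⇔-∘ ∈L⇔∈L⟨2,⟩

    Δ⇔≡m' : ∀ d → d ∈Δ ⇔ d ≡ m'
    Δ⇔≡m' d = mk⇔ Δ⇒ Δ⇐
      where
      to : ∀ {k x} → k ∈L x → Len⟨2,2+ m' ⟩ (μ x) k
      to = Equivalence.to ∈L⇔Len
      from : ∀ {k x} → Len⟨2,2+ m' ⟩ (μ x) k → k ∈L x
      from = Equivalence.from ∈L⇔Len

      Δ⇒ : d ∈Δ → d ≡ m'
      Δ⇒ (x , l , l∈ , l+d∈ , 0<d , gap) =
        Len-consecutive m'-odd (to l∈) (to l+d∈) 0<d (λ j l<j j<l+d j∈ → gap j l<j j<l+d (from j∈))

      Δ⇐ : d ≡ m' → d ∈Δ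
      Δ⇐ refl = x , 2 , from x-len-2 , from x-len-2+m' , odd⇒>0 m'-odd ,
                λ j 2<j j<2+m' j∈ → <⇒≱ j<2+m' (Len-spacing m'-odd x-len-2 (to j∈) 2<j)
        where
        x : Carrier
        x = proj₁ (μ-onto (in⟨2,⟩-2* m (2 + m')))
        μx≡ : μ x ≡ 2 * (2 + m')
        μx≡ = proj₂ (μ-onto (in⟨2,⟩-2* m (2 + m')))
        lemma₁ : ∀ m' → 2 * (2 + m') ≡ 2 * 2 + m' * 2
        lemma₁ = solve-∀
        lemma₂ : ∀ m' → 2 * (2 + m') ≡ 2 * (2 + m') + m' * 0
        lemma₂ = solve-∀
        x-len-2 : Len⟨2,2+ m' ⟩ (μ x) 2
        x-len-2 = 2 , ≤-reflexive refl , ≡.trans μx≡ (lemma₁ m')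
        x-len-2+m' : Len⟨2,2+ m' ⟩ (μ x) (2 + m')
        x-len-2+m' = 0 , z≤n , ≡.trans μx≡ (lemma₂ m')

length-injective-⊤ : ∀ {xs ys : List ⊤} → length xs ≡ length ys → xs ≡ ys
length-injective-⊤ {[]}    {[]}    _   = refl
length-injective-⊤ {_ ∷ _} {_ ∷ _} eq  = cong (tt ∷_) (length-injective-⊤ (suc-injective eq))

module Multiples {c ℓ} (G : AbelianGroup c ℓ) where

  open AbelianGroup G
    using (Carrier; _≈_; _∙_; ε; setoid; assoc; identityˡ; identityʳ; ∙-cong; ∙-congˡ)
    renaming (refl to ≈-refl; sym to ≈-sym; trans to ≈-trans)
  open GroupNotions G
  open import Relation.Binary.Reasoning.Setoid setoid

  ·-homo-+ : ∀ x a b → ((a + b) · x) ≈ ((a · x) ∙ (b · x))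
  ·-homo-+ x zero    b = ≈-sym (identityˡ _)
  ·-homo-+ x (suc a) b = ≈-trans (∙-congˡ (·-homo-+ x a b)) (≈-sym (assoc _ _ _))

  ·-annihilates-* : ∀ {x n} → (n · x) ≈ ε → ∀ q → ((q * n) · x) ≈ ε
  ·-annihilates-* n·x≈ε zero    = ≈-refl
  ·-annihilates-* {x} {n} n·x≈ε (suc q) = begin
    (n + q * n) · x          ≈⟨ ·-homo-+ x n (q * n) ⟩
    (n · x) ∙ ((q * n) · x)  ≈⟨ ∙-cong n·x≈ε (·-annihilates-* n·x≈ε q) ⟩
    ε ∙ ε                    ≈⟨ identityˡ ε ⟩
    ε                        ∎

  -- m = ord g, with m = 0 encoding infinite order.
  AnnihilatorIs : Carrier → ℕ → Set ℓ
  AnnihilatorIs g m = ∀ k → (k · g) ≈ ε ⇔ m ∣ k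

  hasOrder⇒annihilatorIs : ∀ {g n} → HasOrder g n → AnnihilatorIs g n
  hasOrder⇒annihilatorIs {g} {n} (0<n , n·g≈ε , minimal) k = mk⇔ to from
    where
    instance
      n≢0 : NonZero n
      n≢0 = >-nonZero 0<n
    below-order : ∀ r → r < n → (r · g) ≈ ε → r ≡ 0
    below-order zero    _   _      = refl
    below-order (suc r) r<n r·g≈ε = contradiction r·g≈ε (minimal (suc r) z<s r<n)
    to : (k · g) ≈ ε → n ∣ k
    to k·g≈ε = m%n≡0⇒n∣m k n (below-order (k % n) (m%n<n k n) remainder-annihilates)
      where
      remainder-annihilates : ((k % n) · g) ≈ ε
      remainder-annihilates = begin
        (k % n) · g                          ≈⟨ identityʳ _ ⟨
        ((k % n) · g) ∙ ε                    ≈⟨ ∙-congˡ (·-annihilates-* n·g≈ε (k / n)) ⟨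
        ((k % n) · g) ∙ (((k / n) * n) · g)  ≈⟨ ·-homo-+ g (k % n) ((k / n) * n) ⟨
        (k % n + (k / n) * n) · g            ≡⟨ cong (_· g) (m≡m%n+[m/n]*n k n) ⟨
        k · g                                ≈⟨ k·g≈ε ⟩
        ε                                    ∎
    from : n ∣ k → (k · g) ≈ ε
    from (divides q refl) = ·-annihilates-* n·g≈ε q

  infiniteOrder⇒annihilatorIs0 : ∀ {g} → InfiniteOrder g → AnnihilatorIs g 0
  infiniteOrder⇒annihilatorIs0 _   zero    = mk⇔ (λ _ → 0 ∣0) (λ _ → ≈-refl)
  infiniteOrder⇒annihilatorIs0 inf (suc k) =
    mk⇔ (λ k·g≈ε → contradiction k·g≈ε (inf (suc k) z<s))
        (λ 0∣1+k → contradiction (0∣⇒≡0 0∣1+k) λ ())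

module PlusMinusSequences {c ℓ} (G : AbelianGroup c ℓ) (g : AbelianGroup.Carrier G) where

  open AbelianGroup G
    using (Carrier; _≈_; _∙_; ε; _⁻¹; setoid; group; commutativeSemigroup;
           assoc; identityˡ; identityʳ; inverseʳ; ∙-congˡ; ∙-congʳ)
    renaming (refl to ≈-refl; sym to ≈-sym; trans to ≈-trans)
  open GroupNotions G
  open Multiples G
  open Factorization (B±single g)
  open import Algebra.Properties.Group group using (identityʳ-unique; x∙y⁻¹≈ε⇒x≈y)
  open import Algebra.Properties.AbelianGroup G using (⁻¹-∙-comm)
  open import Algebra.Properties.CommutativeSemigroup commutativeSemigroup using (x∙yz≈y∙xz)
  open import Relation.Binary.Reasoning.Setoid setoid

  H : RawMonoid ℓ Level.zero
  H = B±single g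

  signedSum≈ : ∀ (es : List (Bool × ⊤)) → ∃ λ p → ∃ λ q →
               p + q ≡ length es × signedSum (λ _ → g) es ≈ (p · g) ∙ (q · g) ⁻¹
  signedSum≈ [] = 0 , 0 , refl , ≈-sym (inverseʳ ε)
  signedSum≈ ((true , _) ∷ es) with signedSum≈ es
  ... | p , q , p+q≡ , s≈ = suc p , q , cong suc p+q≡ , ≈-trans (∙-congˡ s≈) (≈-sym (assoc _ _ _))
  signedSum≈ ((false , _) ∷ es) with signedSum≈ es
  ... | p , q , p+q≡ , s≈ = p , suc q , ≡.trans (+-suc p q) (cong suc p+q≡) , (begin
    g ⁻¹ ∙ signedSum (λ _ → g) es  ≈⟨ ∙-congˡ s≈ ⟩
    g ⁻¹ ∙ ((p · g) ∙ (q · g) ⁻¹)  ≈⟨ x∙yz≈y∙xz _ _ _ ⟩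
    (p · g) ∙ (g ⁻¹ ∙ (q · g) ⁻¹)  ≈⟨ ∙-congˡ (⁻¹-∙-comm g (q · g)) ⟩
    (p · g) ∙ (g ∙ (q · g)) ⁻¹     ∎)

  multiples-cancel : ∀ q e → ((q + e) · g) ≈ (q · g) → (e · g) ≈ ε
  multiples-cancel q e eq = identityʳ-unique (q · g) (e · g) (≈-trans (≈-sym (·-homo-+ g q e)) eq)

  equal-multiples : ∀ p q → (p · g) ≈ (q · g) → ∃ λ u → ∃ λ e → p + q ≡ 2 * u + e × (e · g) ≈ ε
  equal-multiples p q p·g≈q·g with ≤-total q p
  ... | inj₁ q≤p with m≤n⇒∃[o]m+o≡n q≤p
  ...   | e , refl = q , e , lemma q e , multiples-cancel q e p·g≈q·g
    where
    lemma : ∀ q e → (q + e) + q ≡ 2 * q + e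
    lemma = solve-∀
  equal-multiples p q p·g≈q·g | inj₂ p≤q with m≤n⇒∃[o]m+o≡n p≤q
  ...   | e , refl = p , e , lemma p e , multiples-cancel p e (≈-sym p·g≈q·g)
    where
    lemma : ∀ p e → p + (p + e) ≡ 2 * p + e
    lemma = solve-∀

  zeroSum-length : ∀ {S : List ⊤} → IsPMZeroSum (λ _ → g) S →
                   ∃ λ u → ∃ λ e → length S ≡ 2 * u + e × (e · g) ≈ ε
  zeroSum-length (es , refl , sum≈ε) with signedSum≈ es
  ... | p , q , p+q≡ , s≈ with equal-multiples p q (x∙y⁻¹≈ε⇒x≈y _ _ (≈-trans (≈-sym s≈) sum≈ε))
  ...   | u , e , p+q≡2u+e , e·g≈ε =
    u , e , ≡.trans (length-map proj₂ es) (≡.trans (≡.sym p+q≡) p+q≡2u+e) , e·g≈ε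

  cancelling-pairs : ℕ → List (Bool × ⊤)
  cancelling-pairs zero    = []
  cancelling-pairs (suc u) = (true , tt) ∷ (false , tt) ∷ cancelling-pairs u

  signedSum-cancelling-pairs : ∀ u es →
    signedSum (λ _ → g) (cancelling-pairs u ++ es) ≈ signedSum (λ _ → g) es
  signedSum-cancelling-pairs zero    es = ≈-refl
  signedSum-cancelling-pairs (suc u) es = begin
    g ∙ (g ⁻¹ ∙ s)  ≈⟨ assoc _ _ _ ⟨
    (g ∙ g ⁻¹) ∙ s  ≈⟨ ∙-congʳ (inverseʳ g) ⟩
    ε ∙ s           ≈⟨ identityˡ _ ⟩
    _               ≈⟨ signedSum-cancelling-pairs u es ⟩
    _               ∎
    where
    s : Carrier
    s = signedSum (λ _ → g) (cancelling-pairs u ++ es)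

  signedSum-replicate : ∀ e → signedSum (λ _ → g) (replicate e (true , tt)) ≈ (e · g)
  signedSum-replicate zero    = ≈-refl
  signedSum-replicate (suc e) = ∙-congˡ (signedSum-replicate e)

  length-cancelling-pairs : ∀ u → length (cancelling-pairs u) ≡ 2 * u
  length-cancelling-pairs zero    = refl
  length-cancelling-pairs (suc u) = ≡.trans (cong (2 +_) (length-cancelling-pairs u)) (≡.sym (*-suc 2 u))

  len : RawMonoid.Carrier H → ℕ
  len S = length (proj₁ S)

  zeroSum-of-length : ∀ u e → (e · g) ≈ ε → Σ (RawMonoid.Carrier H) λ S → len S ≡ 2 * u + e
  zeroSum-of-length u e e·g≈ε =
    (map proj₂ es , es , refl , ≈-trans (signedSum-cancelling-pairs u _) (≈-trans (signedSum-replicate e) e·g≈ε)) ,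
    ≡.trans (length-map proj₂ es)
      (≡.trans (length-++ (cancelling-pairs u)) (cong₂ _+_ (length-cancelling-pairs u) (length-replicate e)))
    where
    es : List (Bool × ⊤)
    es = cancelling-pairs u ++ replicate e (true , tt)

  len-isMonoidMonomorphism : MonoidMorphisms.IsMonoidMonomorphism H ℕ+ len
  len-isMonoidMonomorphism = record
    { isMonoidHomomorphism = record
      { isMagmaHomomorphism = record
        { isRelHomomorphism = record { cong = ↭-length }
        ; homo = λ S T → length-++ (proj₁ S)
        }
      ; ε-homo = refl
      }
    ; injective = λ {S} {T} eq → subst (proj₁ S ↭_) (length-injective-⊤ eq) ↭-refl
    }

  module _ {m} (annihilator : AnnihilatorIs g m) where

    len-image : ∀ S → In⟨2, m ⟩ (len S)
    len-image (_ , pm) with zeroSum-length pm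
    ... | u , e , len≡ , e·g≈ε with Equivalence.to (annihilator e) e·g≈ε
    ...   | divides q refl = u , q , ≡.trans len≡ (cong (2 * u +_) (*-comm q m))

    len-onto : ∀ {n} → In⟨2, m ⟩ n → Σ (RawMonoid.Carrier H) λ S → len S ≡ n
    len-onto (a , b , refl) = zeroSum-of-length a (m * b) (Equivalence.from (annihilator (m * b)) (divides b (*-comm m b)))

    open LengthEmbedding H len len-isMonoidMonomorphism m len-image len-onto public

  B±-even-or-infinite : (Σ ℕ λ n → HasOrder g n × Even n) ⊎ InfiniteOrder g →
    Σ (RawMonoid.Carrier H → ℕ) (MonoidMorphisms.IsMonoidIsomorphism H ℕ+) × (∀ d → ¬ (d ∈Δ))
  B±-even-or-infinite (inj₁ (n , ord , n-even)) =
    (_ , halve-isMonoidIsomorphism (hasOrder⇒annihilatorIs ord) n-even) , Δ-empty (hasOrder⇒annihilatorIs ord) n-even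
  B±-even-or-infinite (inj₂ inf) =
    (_ , halve-isMonoidIsomorphism (infiniteOrder⇒annihilatorIs0 inf) (0 , refl)) ,
    Δ-empty (infiniteOrder⇒annihilatorIs0 inf) (0 , refl)

  B±-odd : ¬ (g ≈ ε) → (n : ℕ) → HasOrder g n → Odd n →
    Σ (RawMonoid.Carrier H → RawMonoid.Carrier ⟨2, n ⟩) (MonoidMorphisms.IsMonoidIsomorphism H ⟨2, n ⟩)
    × (∀ d → (d ∈Δ) ⇔ (d ≡ n ∸ 2))
  B±-odd g≉ε n (_ , 1·g≈ε , _) (zero , refl) = contradiction (≈-trans (≈-sym (identityʳ g)) 1·g≈ε) g≉ε
  B±-odd g≉ε n ord (suc r , refl) =
    (_ , toNumerical-isMonoidIsomorphism (hasOrder⇒annihilatorIs ord)) ,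
    Δ⇔≡m' (hasOrder⇒annihilatorIs ord) refl (r , +-suc r (r + 0))

lemma4p7 : {c ℓ : Level} (G : AbelianGroup c ℓ) (g : AbelianGroup.Carrier G) →
  ¬ (AbelianGroup._≈_ G g (AbelianGroup.ε G)) →
  let open GroupNotions G
      H = B±single g
      open Factorization H
  in (((Σ ℕ λ n → HasOrder g n × Even n) ⊎ InfiniteOrder g) →
        (Σ (RawMonoid.Carrier H → ℕ) (MonoidMorphisms.IsMonoidIsomorphism H ℕ+))
        × (∀ d → ¬ (d ∈Δ)))
     × ((n : ℕ) → HasOrder g n → Odd n →
        (Σ (RawMonoid.Carrier H → RawMonoid.Carrier ⟨2, n ⟩)
           (MonoidMorphisms.IsMonoidIsomorphism H ⟨2, n ⟩))
        × (∀ d → (d ∈Δ) ⇔ (d ≡ n ∸ 2)))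
lemma4p7 G g g≉ε = B±-even-or-infinite , B±-odd g≉ε
  where open PlusMinusSequences G g
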